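{- Let $i\ge0$ be an integer and let $G=(V,E)$ be an $\alpha_i$-metric graph with $n>1$ vertices. Then every BFS-ordering of $G$ is an $(r,\lceil r/2\rceil+2i+1)^*$-dismantling ordering of $G$ for every integer $r>0$.
   Context: All graphs are finite, undirected, unweighted, simple and connected; $d$ is the shortest-path distance, $I(u,v)=\{z : d(u,v)=d(u,z)+d(z,v)\}$, $D(v,r)=\{z: d(v,z)\le r\}$. A graph is $\alpha_i$-metric if for all vertices $u,v,w,x$ with $v\in I(u,w)$, $w\in I(v,x)$ and $v,w$ adjacent, $d(u,x)\ge d(u,v)+d(v,x)-i$. An ordering $v_1,\dots,v_n$ of $V$ is an $(s,s')^*$-dismantling ordering if for each $k<n$ there exists $\ell>k$ with $D(v_k,s)\cap V_k\subseteq D(v_\ell,s')$, where $V_k=\{v_k,\dots,v_n\}$ and disks are taken in $G$. A BFS-ordering (started at $u$) is an ordering $v_1,\dots,v_n$ with $v_n=u$ which is the reverse of the order in which a breadth-first search from $u$ visits the vertices; in particular $d(u,v_k)\ge d(u,v_j)$ whenever $k<j$. -}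

module Defs where

open import Data.Nat using (ℕ; zero; suc; _+_; _≤_; _<_)
open import Data.Fin using (Fin; toℕ; opposite)
open import Data.Product using (Σ; ∃; _×_; _,_)
open import Relation.Binary.PropositionalEquality using (_≡_)
open import Relation.Nullary using (¬_)
open import Function.Definitions using (Injective)

record Graph (n : ℕ) : Set₁ where
  field
    Adj   : Fin n → Fin n → Set
    sym   : ∀ {u v} → Adj u v → Adj v u
    irrefl : ∀ {u} → ¬ Adj u u

module _ {n : ℕ} (G : Graph n) where
  open Graph G

  data Walk : Fin n → Fin n → ℕ → Set where
    here : ∀ {u} → Walk u u zero
    step : ∀ {u w v k} → Adj u w → Walk w v k → Walk u v (suc k)

  Connected : Set
  Connected = ∀ u v → ∃ λ k → Walk u v k

  IsShortestPathDistance : (Fin n → Fin n → ℕ) → Set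
  IsShortestPathDistance d =
    (∀ u v → Walk u v (d u v)) × (∀ u v k → Walk u v k → d u v ≤ k)

module _ {n : ℕ} (G : Graph n) (d : Fin n → Fin n → ℕ) where
  open Graph G

  InInterval : Fin n → Fin n → Fin n → Set
  InInterval u v z = d u v ≡ d u z + d z v

  InDisk : Fin n → ℕ → Fin n → Set
  InDisk v r z = d v z ≤ r

  -- α_i-metric:  d(u,x) ≥ d(u,v) + d(v,x) − i, stated without truncated subtraction
  IsAlphaMetric : ℕ → Set
  IsAlphaMetric i = ∀ u v w x → InInterval u w v → InInterval v x w → Adj v w →
                    d u v + d v x ≤ d u x + i

  -- (s,s')^*-dismantling ordering; the ordering is v : Fin n → Fin n (injective),
  -- v k is the (k+1)-th vertex; V_k = { v j : k ≤ j }.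
  IsDismantling : (Fin n → Fin n) → ℕ → ℕ → Set
  IsDismantling v s s' =
    Injective _≡_ _≡_ v ×
    (∀ (k : Fin n) → suc (toℕ k) < n →
       Σ (Fin n) λ ℓ → (toℕ k < toℕ ℓ) ×
         (∀ z → InDisk (v k) s z → (∃ λ j → (toℕ k ≤ toℕ j) × (v j ≡ z)) →
                InDisk (v ℓ) s' z))

  -- w is a BFS visit order started at u: w 0 = u, w injective, every later
  -- vertex has an earlier neighbour, and the index of the earliest earlier
  -- neighbour (the vertex from whose processing it was enqueued) is
  -- nondecreasing along the order (FIFO queue).
  IsBFSVisitOrder : Fin n → (Fin n → Fin n) → Set
  IsBFSVisitOrder u w =
    Injective _≡_ _≡_ w ×
    (∀ (j : Fin n) → toℕ j ≡ 0 → w j ≡ u) ×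
    (∀ (j : Fin n) → 0 < toℕ j → ∃ λ (i : Fin n) → (toℕ i < toℕ j) × Adj (w i) (w j)) ×
    (∀ (j k : Fin n) → 0 < toℕ j → toℕ j < toℕ k →
       ∀ (a : Fin n) → Adj (w a) (w k) →
         ∃ λ (b : Fin n) → (toℕ b ≤ toℕ a) × Adj (w b) (w j))

  -- BFS-ordering (started at u): the reverse of a BFS visit order, so v_n = u.
  IsBFSOrdering : Fin n → (Fin n → Fin n) → Set
  IsBFSOrdering u v = IsBFSVisitOrder u (λ k → v (opposite k))

{-# OPTIONS --safe #-}
-- Let c = v k and t = ⌈r/2⌉. A BFS ordering lists vertices by non-increasing distance from u,
-- so every vertex of V_k is at most d(u,c) from u. If d(u,c) < t, the root u dominates.
-- Otherwise take x on a c–u geodesic with d(c,x) = t; x comes later than c. In an α_i-metric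
-- graph the slice of I(c,u) at distance t from c has diameter at most i+1, and for z in
-- D(c,r) ∩ V_k some vertex y of that slice has d(y,z) ≤ t+i: walk from x towards z inside the
-- slice, and the first step that would leave it triggers the α_i inequality at c or at u.
-- Hence d(x,z) ≤ (i+1) + (t+i).
module Submission where

open import Defs
open import Data.Nat using (ℕ; _+_; _*_; _<_; ⌈_/2⌉)
open import Data.Fin using (Fin)
open import Data.Nat using (zero; suc; _≤_; z≤n; s≤s; _∸_; _≤?_)
open import Data.Nat.Properties
open import Data.Nat.Solver using (module +-*-Solver)
open import Data.Fin as Fin using (toℕ; opposite; punchOut)
import Data.Fin.Properties as Finₚ
open import Data.Product using (Σ; ∃; _×_; _,_; proj₁; proj₂)
open import Data.Sum using (_⊎_; inj₁; inj₂)
open import Function using (_∘_)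
open import Function.Definitions using (Injective)
open import Relation.Nullary using (¬_; yes; no; contradiction)
open import Relation.Binary using (tri<; tri≈; tri>)
open import Relation.Binary.PropositionalEquality

+-tight : ∀ {a b t s} → a ≤ t → b ≤ s → t + s ≤ a + b → a ≡ t × b ≡ s
+-tight {a} {b} {t} {s} a≤t b≤s t+s≤a+b = a≡t , b≡s
  where
  a≡t : a ≡ t
  a≡t = ≤-antisym a≤t (+-cancelʳ-≤ s t a (≤-trans t+s≤a+b (+-monoʳ-≤ a b≤s)))
  b≡s : b ≡ s
  b≡s = ≤-antisym b≤s (+-cancelˡ-≤ t s b (subst (λ c → t + s ≤ c + b) a≡t t+s≤a+b))

n≤⌈n/2⌉+⌈n/2⌉ : ∀ n → n ≤ ⌈ n /2⌉ + ⌈ n /2⌉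
n≤⌈n/2⌉+⌈n/2⌉ n = subst (_≤ ⌈ n /2⌉ + ⌈ n /2⌉) (⌊n/2⌋+⌈n/2⌉≡n n) (+-monoˡ-≤ ⌈ n /2⌉ (⌊n/2⌋≤⌈n/2⌉ n))

injective⇒surjective : ∀ {n} {f : Fin n → Fin n} → Injective _≡_ _≡_ f → ∀ y → ∃ λ x → f x ≡ y
injective⇒surjective {suc m} {f} f-injective y with Finₚ.any? (λ x → f x Finₚ.≟ y)
... | yes hit = hit
... | no miss = contradiction (Finₚ.injective⇒≤ punchOut∘f-injective) 1+n≰n
  where
  y≢f : ∀ x → y ≢ f x
  y≢f x y≡fx = miss (x , sym y≡fx)
  punchOut∘f : Fin (suc m) → Fin m
  punchOut∘f x = punchOut (y≢f x)
  punchOut∘f-injective : Injective _≡_ _≡_ punchOut∘f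
  punchOut∘f-injective eq = f-injective (Finₚ.punchOut-injective (y≢f _) (y≢f _) eq)

module Walks {n : ℕ} (G : Graph n) where
  open Graph G using (Adj) renaming (sym to Adj-sym)

  _▷_ : ∀ {a b c k} → Walk G a b k → Adj b c → Walk G a c (suc k)
  here ▷ e = step e here
  step e′ p ▷ e = step e′ (p ▷ e)

  reverse : ∀ {a b k} → Walk G a b k → Walk G b a k
  reverse here = here
  reverse (step e p) = reverse p ▷ Adj-sym e

  _++_ : ∀ {a b c k l} → Walk G a b k → Walk G b c l → Walk G a c (k + l)
  here ++ q = q
  step e p ++ q = step e (p ++ q)

  splitAt : ∀ {a b} k {l} → Walk G a b (k + l) → ∃ λ c → Walk G a c k × Walk G c b l
  splitAt zero p = _ , here , p
  splitAt (suc k) (step e p) with c , p₁ , p₂ ← splitAt k p = c , step e p₁ , p₂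

  empty-walk : ∀ {a b} → Walk G a b 0 → a ≡ b
  empty-walk here = refl

module Metric {n : ℕ} (G : Graph n) (d : Fin n → Fin n → ℕ) (isSP : IsShortestPathDistance G d) where
  open Graph G using (Adj; irrefl) renaming (sym to Adj-sym)
  open Walks G

  private
    variable
      a b p q w x y : Fin n
      k t s : ℕ

    geodesic : ∀ a b → Walk G a b (d a b)
    geodesic = proj₁ isSP

    minimal : ∀ a b k → Walk G a b k → d a b ≤ k
    minimal = proj₂ isSP

  d-sym : ∀ a b → d a b ≡ d b a
  d-sym a b = ≤-antisym (minimal a b _ (reverse (geodesic b a))) (minimal b a _ (reverse (geodesic a b)))

  d-triangle : ∀ a b c → d a c ≤ d a b + d b c
  d-triangle a b c = minimal a c _ (geodesic a b ++ geodesic b c)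

  d-refl : ∀ a → d a a ≡ 0
  d-refl a = n≤0⇒n≡0 (minimal a a 0 here)

  d≡0⇒≡ : d a b ≡ 0 → a ≡ b
  d≡0⇒≡ {a} {b} eq = empty-walk (subst (Walk G a b) eq (geodesic a b))

  adj⇒d≡1 : Adj a b → d a b ≡ 1
  adj⇒d≡1 {a} {b} e = ≤-antisym (minimal a b 1 (step e here))
    (n≢0⇒n>0 λ ab≡0 → irrefl (subst (Adj a) (sym (d≡0⇒≡ ab≡0)) e))

  adj-lipschitzˡ : Adj a b → ∀ w → d a w ≤ suc (d b w)
  adj-lipschitzˡ {a} {b} e w = ≤-trans (d-triangle a b w) (+-monoˡ-≤ (d b w) (≤-reflexive (adj⇒d≡1 e)))

  adj-lipschitzʳ : Adj a b → ∀ w → d w a ≤ suc (d w b)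
  adj-lipschitzʳ {a} {b} e w = subst₂ _≤_ (d-sym a w) (cong suc (d-sym b w)) (adj-lipschitzˡ e w)

  adj-trichotomy : Adj a b → ∀ w → d b w ≡ suc (d a w) ⊎ d b w ≡ d a w ⊎ d a w ≡ suc (d b w)
  adj-trichotomy {a} {b} e w with <-cmp (d a w) (d b w)
  ... | tri< a<b _ _ = inj₁ (≤-antisym (adj-lipschitzˡ (Adj-sym e) w) a<b)
  ... | tri≈ _ a≡b _ = inj₂ (inj₁ (sym a≡b))
  ... | tri> _ _ b<a = inj₂ (inj₂ (≤-antisym (adj-lipschitzˡ e w) b<a))

  geodesic-step : d a b ≡ suc k → ∃ λ c → Adj a c × d c b ≡ k
  geodesic-step {a} {b} {k} eq with subst (Walk G a b) eq (geodesic a b)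
  ... | step {w = c} e p =
    c , e , ≤-antisym (minimal c b k p) (≤-pred (subst (_≤ suc (d c b)) eq (adj-lipschitzˡ e b)))

  closer-neighbour : d a b ≤ suc k → a ≡ b ⊎ ∃ λ c → Adj a c × d c b ≤ k
  closer-neighbour {a} {b} {k} ab≤1+k with d a b in eq
  ... | zero = inj₁ (d≡0⇒≡ eq)
  ... | suc _ with c , e , cb ← geodesic-step eq = inj₂ (c , e , subst (_≤ k) (sym cb) (≤-pred ab≤1+k))

  -- Used only when d p q ≡ t + s; it is then the set of vertices of I(p,q) at distance t from p.
  Slice : Fin n → Fin n → ℕ → ℕ → Fin n → Set
  Slice p q t s y = d p y ≡ t × d q y ≡ s

  slice-of-bounds : d p q ≡ t + s → d p y ≤ t → d q y ≤ s → Slice p q t s y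
  slice-of-bounds {p} {q} {t} {s} {y} pq py qy = +-tight py qy (begin
    t + s           ≡⟨ sym pq ⟩
    d p q           ≤⟨ d-triangle p y q ⟩
    d p y + d y q   ≡⟨ cong (d p y +_) (d-sym y q) ⟩
    d p y + d q y   ∎)
    where open ≤-Reasoning

  slice-point : d p q ≡ t + s → ∃ (Slice p q t s)
  slice-point {p} {q} {t} {s} pq with x , p₁ , p₂ ← splitAt t (subst (Walk G p q) pq (geodesic p q)) =
    x , slice-of-bounds pq (minimal p x t p₁) (minimal q x s (reverse p₂))

  slice-descend : d p q ≡ suc t + s → Slice p q (suc t) s x → ∃ λ x′ → Adj x x′ × Slice p q t (suc s) x′
  slice-descend {p} {q} {t} {s} {x} pq (px , qx) with x′ , e , x′p ← geodesic-step (trans (d-sym x p) px) =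
    x′ , e , slice-of-bounds (trans pq (sym (+-suc t s)))
                             (≤-reflexive (trans (d-sym p x′) x′p))
                             (subst (λ c → d q x′ ≤ suc c) qx (adj-lipschitzʳ (Adj-sym e) q))

  slice-neighbour : d p q ≡ t + s → Slice p q t s x → Adj x y →
                    Slice p q t s y ⊎ d p y ≡ suc t ⊎ d q y ≡ suc s
  slice-neighbour {p} {q} {t} {s} {x} {y} pq (px , qx) e
    with m≤n⇒m<n∨m≡n (subst (λ c → d p y ≤ suc c) px (adj-lipschitzʳ (Adj-sym e) p))
       | m≤n⇒m<n∨m≡n (subst (λ c → d q y ≤ suc c) qx (adj-lipschitzʳ (Adj-sym e) q))
  ... | inj₂ py≡1+t      | _                 = inj₂ (inj₁ py≡1+t)
  ... | inj₁ _           | inj₂ qy≡1+s       = inj₂ (inj₂ qy≡1+s)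
  ... | inj₁ (s≤s py≤t)  | inj₁ (s≤s qy≤s)   = inj₁ (slice-of-bounds pq py≤t qy≤s)

  module AlphaMetric (i : ℕ) (isα : IsAlphaMetric G d i) where

    α-bound : ∀ {δ} → Adj a b → d p a ≡ t → d p b ≡ suc t → d a w ≡ suc k → d b w ≡ k →
              d p w ≤ δ + t → d a w ≤ δ + i
    α-bound {a} {b} {p} {t} {w} {k} {δ} e pa pb aw bw pw = +-cancelˡ-≤ t (d a w) (δ + i) (begin
      t + d a w       ≡⟨ cong (_+ d a w) (sym pa) ⟩
      d p a + d a w   ≤⟨ isα p a b w a∈I[p,b] b∈I[a,w] e ⟩
      d p w + i       ≤⟨ +-monoˡ-≤ i pw ⟩
      δ + t + i       ≡⟨ cong (_+ i) (+-comm δ t) ⟩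
      t + δ + i       ≡⟨ +-assoc t δ i ⟩
      t + (δ + i)     ∎)
      where
      open ≤-Reasoning
      a∈I[p,b] : d p b ≡ d p a + d a b
      a∈I[p,b] = trans pb (trans (+-comm 1 t) (cong₂ _+_ (sym pa) (sym (adj⇒d≡1 e))))
      b∈I[a,w] : d a w ≡ d a b + d b w
      b∈I[a,w] = trans aw (cong₂ _+_ (sym (adj⇒d≡1 e)) (sym bw))

    -- Descend x and y one level towards p; unless their distance stays the same (induction),
    -- α_i at p or at q bounds it.
    slice-diameter : ∀ t {s x y} → d p q ≡ t + s → Slice p q t s x → Slice p q t s y → d x y ≤ suc i
    slice-diameter {p} zero _ (px , _) (py , _) with refl ← d≡0⇒≡ px | refl ← d≡0⇒≡ py =
      ≤-trans (≤-reflexive (d-refl p)) z≤n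
    slice-diameter {p} {q} (suc t) {s} {x} {y} pq X@(px , qx) Y@(py , qy)
      with x′ , xx′ , X′@(px′ , qx′) ← slice-descend pq X
         | y′ , yy′ , Y′@(py′ , qy′) ← slice-descend pq Y
         | adj-trichotomy xx′ y
    ... | inj₁ x′y≡1+xy =
      m≤n⇒m≤1+n (≤-pred (subst (_≤ suc i) x′y≡1+xy
        (α-bound (Adj-sym xx′) px′ px x′y≡1+xy refl (≤-reflexive py))))
    ... | inj₂ (inj₂ xy≡1+x′y) =
      m≤n⇒m≤1+n (α-bound xx′ qx qx′ xy≡1+x′y refl (≤-reflexive qy))
    ... | inj₂ (inj₁ x′y≡xy) = subst (_≤ suc i) (trans (d-sym y x′) x′y≡xy) yx′≤1+i
      where
      yx′≤1+i : d y x′ ≤ suc i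
      yx′≤1+i with adj-trichotomy yy′ x′
      ... | inj₁ y′x′≡1+yx′ =
        m≤n⇒m≤1+n (<⇒≤ (subst (_≤ i) y′x′≡1+yx′
          (α-bound (Adj-sym yy′) py′ py y′x′≡1+yx′ refl (≤-reflexive px′))))
      ... | inj₂ (inj₂ yx′≡1+y′x′) = α-bound yy′ qy qy′ yx′≡1+y′x′ refl (≤-reflexive qx′)
      ... | inj₂ (inj₁ y′x′≡yx′) =
        subst (_≤ suc i) (trans (d-sym x′ y′) y′x′≡yx′)
              (slice-diameter t (trans pq (sym (+-suc t s))) X′ Y′)

    slice-approach : ∀ {δ z} → d p q ≡ t + s → d p z ≤ δ + t → d q z ≤ δ + s → Slice p q t s y →
                     ∃ λ y* → Slice p q t s y* × d y* z ≤ δ + i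
    slice-approach {p} {q} {t} {s} {y} {δ} {z} pq pz qz = walk (d y z) refl
      where
      walk : ∀ m {y} → d y z ≡ m → Slice p q t s y → ∃ λ y* → Slice p q t s y* × d y* z ≤ δ + i
      walk zero {y} yz Y = y , Y , ≤-trans (≤-reflexive yz) z≤n
      walk (suc m) {y} yz Y@(py , qy) with y₁ , e , y₁z ← geodesic-step yz | slice-neighbour pq Y e
      ... | inj₁ Y₁ = walk m y₁z Y₁
      ... | inj₂ (inj₁ py₁≡1+t) = y , Y , α-bound e py py₁≡1+t yz y₁z pz
      ... | inj₂ (inj₂ qy₁≡1+s) = y , Y , α-bound e qy qy₁≡1+s yz y₁z qz

    slice-dist-bound : ∀ {z} → d p q ≡ t + s → Slice p q t s x → d p z ≤ t + t → d q z ≤ t + s →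
                       d x z ≤ t + 2 * i + 1
    slice-dist-bound {p} {q} {t} {s} {x} {z} pq X pz qz
      with y* , Y* , y*z ← slice-approach pq pz qz X = begin
      d x z              ≤⟨ d-triangle x y* z ⟩
      d x y* + d y* z    ≤⟨ +-mono-≤ (slice-diameter t pq X Y*) y*z ⟩
      suc i + (t + i)    ≡⟨ solve 2 (λ t i → (con 1 :+ i) :+ (t :+ i) := t :+ con 2 :* i :+ con 1) refl t i ⟩
      t + 2 * i + 1      ∎
      where
      open ≤-Reasoning
      open +-*-Solver

module BFSVisitOrder {m : ℕ} (G : Graph (suc m)) (d : Fin (suc m) → Fin (suc m) → ℕ)
                     (isSP : IsShortestPathDistance G d) (u : Fin (suc m)) (w : Fin (suc m) → Fin (suc m))
                     (isVisit : IsBFSVisitOrder G d u w) where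
  open Graph G using (Adj) renaming (sym to Adj-sym)
  open Metric G d isSP

  w-injective : Injective _≡_ _≡_ w
  w-injective = proj₁ isVisit

  w-root : ∀ j → toℕ j ≡ 0 → w j ≡ u
  w-root = proj₁ (proj₂ isVisit)

  private
    fifo : ∀ j k → 0 < toℕ j → toℕ j < toℕ k →
           ∀ a → Adj (w a) (w k) → ∃ λ b → toℕ b ≤ toℕ a × Adj (w b) (w j)
    fifo = proj₂ (proj₂ (proj₂ isVisit))

  nothing-before-root : ∀ {a j : Fin (suc m)} → w a ≡ u → ¬ toℕ j < toℕ a
  nothing-before-root {a} {j} wa≡u j<a =
    n≮0 (subst (toℕ j <_) (cong toℕ (w-injective (trans wa≡u (sym (w-root Fin.zero refl))))) j<a)

  -- FIFO: w j, visited before w a, has a neighbour visited no later than the neighbour of w a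
  -- that is closer to u.
  visit-bounded : ∀ s {a j} → d u (w a) ≤ s → toℕ j < toℕ a → d u (w j) ≤ s
  visit-bounded zero ua≤0 j<a = contradiction j<a (nothing-before-root (sym (d≡0⇒≡ (n≤0⇒n≡0 ua≤0))))
  visit-bounded (suc s) {a} {j} ua≤1+s j<a
    with toℕ j ≟ 0 | closer-neighbour (subst (_≤ suc s) (d-sym u (w a)) ua≤1+s)
  ... | yes j≡0 | _ = ≤-trans (≤-reflexive (trans (cong (d u) (w-root j j≡0)) (d-refl u))) z≤n
  ... | no _    | inj₁ wa≡u = contradiction j<a (nothing-before-root wa≡u)
  ... | no j≢0  | inj₂ (c , e , cu≤s)
    with a′ , refl ← injective⇒surjective w-injective c
    with b , b≤a′ , wb~wj ← fifo j a (n≢0⇒n>0 j≢0) j<a a′ (Adj-sym e)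
    = ≤-trans (adj-lipschitzʳ (Adj-sym wb~wj) u) (s≤s ub≤s)
    where
    ub≤s : d u (w b) ≤ s
    ub≤s with m≤n⇒m<n∨m≡n b≤a′
    ... | inj₁ b<a′ = visit-bounded s (subst (_≤ s) (d-sym (w a′) u) cu≤s) b<a′
    ... | inj₂ b≡a′ rewrite Finₚ.toℕ-injective b≡a′ = subst (_≤ s) (d-sym (w a′) u) cu≤s

module BFSOrdering {m : ℕ} (G : Graph (suc m)) (d : Fin (suc m) → Fin (suc m) → ℕ)
                   (isSP : IsShortestPathDistance G d) (u : Fin (suc m)) (v : Fin (suc m) → Fin (suc m))
                   (isBFS : IsBFSOrdering G d u v) where
  open Metric G d isSP
  open BFSVisitOrder G d isSP u (v ∘ opposite) isBFS

  private
    v≡w∘opposite : ∀ k → v k ≡ v (opposite (opposite k))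
    v≡w∘opposite k = cong v (sym (Finₚ.opposite-involutive k))

    opposite-injective : Injective _≡_ _≡_ (opposite {suc m})
    opposite-injective {x} {y} eq =
      trans (sym (Finₚ.opposite-involutive x)) (trans (cong opposite eq) (Finₚ.opposite-involutive y))

    opposite-reverses-< : ∀ {k j : Fin (suc m)} → toℕ k < toℕ j → toℕ (opposite j) < toℕ (opposite k)
    opposite-reverses-< {k} {j} k<j = subst₂ _<_ (sym (Finₚ.opposite-prop j)) (sym (Finₚ.opposite-prop k))
                                              (∸-monoʳ-< (s≤s k<j) (Finₚ.toℕ<n j))

  v-injective : Injective _≡_ _≡_ v
  v-injective {x} {y} vx≡vy =
    opposite-injective (w-injective (trans (sym (v≡w∘opposite x)) (trans vx≡vy (v≡w∘opposite y))))

  v-last : v (Fin.fromℕ m) ≡ u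
  v-last = w-root Fin.zero refl

  distance-antitone : ∀ {k j} → toℕ k ≤ toℕ j → d u (v j) ≤ d u (v k)
  distance-antitone {k} {j} k≤j with m≤n⇒m<n∨m≡n k≤j
  ... | inj₂ k≡j rewrite Finₚ.toℕ-injective k≡j = ≤-refl
  ... | inj₁ k<j = subst₂ _≤_ (cong (d u) (sym (v≡w∘opposite j))) (cong (d u) (sym (v≡w∘opposite k)))
                           (visit-bounded _ ≤-refl (opposite-reverses-< k<j))

  later-if-closer : ∀ {k ℓ} → d u (v ℓ) < d u (v k) → toℕ k < toℕ ℓ
  later-if-closer closer = ≰⇒> (λ ℓ≤k → <⇒≱ closer (distance-antitone ℓ≤k))

  Dominated : Fin (suc m) → ℕ → ℕ → Set
  Dominated k r r′ = Σ (Fin (suc m)) λ ℓ → toℕ k < toℕ ℓ ×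
    (∀ z → InDisk G d (v k) r z → (∃ λ j → toℕ k ≤ toℕ j × v j ≡ z) → InDisk G d (v ℓ) r′ z)

  root-dominates : ∀ {k r r′} → suc (toℕ k) < suc m → d u (v k) ≤ r′ → Dominated k r r′
  root-dominates {k} (s≤s k<m) uk≤r′ =
    Fin.fromℕ m , subst (toℕ k <_) (sym (Finₚ.toℕ-fromℕ m)) k<m , λ { _ _ (j , k≤j , refl) →
      subst (λ c → d c (v j) ≤ _) (sym v-last) (≤-trans (distance-antitone k≤j) uk≤r′) }

  module _ (i : ℕ) (isα : IsAlphaMetric G d i) where
    open AlphaMetric i isα

    midpoint-dominates : ∀ {k r t h} → 0 < t → d u (v k) ≡ t + h → r ≤ t + t →
                         Dominated k r (t + 2 * i + 1)
    midpoint-dominates {k} {r} {t} {h} 0<t uk≡t+h r≤2t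
      with x , X@(_ , ux≡h) ← slice-point (trans (d-sym (v k) u) uk≡t+h)
      with ℓ , refl ← injective⇒surjective v-injective x
      = ℓ , later-if-closer ℓ-closer , λ { _ kz≤r (j , k≤j , refl) →
          slice-dist-bound (trans (d-sym (v k) u) uk≡t+h) X (≤-trans kz≤r r≤2t)
                           (≤-trans (distance-antitone k≤j) (≤-reflexive uk≡t+h)) }
      where
      ℓ-closer : d u (v ℓ) < d u (v k)
      ℓ-closer = subst₂ _<_ (sym ux≡h) (sym uk≡t+h) (m<n+m h 0<t)

lemma6 : (i n : ℕ) → 1 < n → (G : Graph n) → Connected G →
    (d : Fin n → Fin n → ℕ) → IsShortestPathDistance G d →
    IsAlphaMetric G d i →
    ∀ (u : Fin n) (v : Fin n → Fin n) → IsBFSOrdering G d u v →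
    ∀ (r : ℕ) → 0 < r → IsDismantling G d v r (⌈ r /2⌉ + 2 * i + 1)
lemma6 i (suc m) _ G _ d isSP isα u v isBFS r@(suc _) _ = v-injective , dominated
  where
  open BFSOrdering G d isSP u v isBFS
  t = ⌈ r /2⌉

  dominated : ∀ k → suc (toℕ k) < suc m → Dominated k r (t + 2 * i + 1)
  dominated k k≠last with t ≤? d u (v k)
  ... | yes t≤uk = midpoint-dominates i isα (s≤s z≤n) (sym (m+[n∸m]≡n t≤uk)) (n≤⌈n/2⌉+⌈n/2⌉ r)
  ... | no  t≰uk = root-dominates k≠last (m≤n⇒m≤n+o 1 (m≤n⇒m≤n+o (2 * i) (<⇒≤ (≰⇒> t≰uk))))
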